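{- For every integer $n>1$ there exists a graph $G_n$ on $n$ vertices with exactly $2n-3$ edges that has a canonical ESD labeling.
   Context: For a graph $G=(V,E)$ and $l\in\mathbb N$, a vertex labeling $\phi:V\to\{1,\dots,l\}$ is an edge-sum distinguishing (ESD) labeling if $\phi$ is injective and the edge-weights $w_\phi(uv)=\phi(u)+\phi(v)$ are pairwise distinct over all edges $uv\in E$. It is a canonical ESD labeling if $l=|V|$. Graphs are finite, simple, connected. -}

module Defs where

open import Data.Nat using (ℕ; suc; _+_; _≤_)
open import Data.Fin using (Fin; _<_)
open import Data.Product using (_×_; _,_; proj₁; proj₂; Σ)
open import Data.List using (List; length; map)
open import Data.List.Membership.Propositional using (_∈_)
open import Data.List.Relation.Unary.All using (All)
open import Data.List.Relation.Unary.Unique.Propositional using (Unique)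
open import Function.Definitions using (Injective)
open import Relation.Binary.PropositionalEquality using (_≡_)

-- Each edge {u,v} is stored once as the pair (u , v) with u < v
-- (so no loops), and the list has no duplicates (so no multi-edges).
record Graph (n : ℕ) : Set where
  field
    edges    : List (Fin n × Fin n)
    ordered  : All (λ e → proj₁ e < proj₂ e) edges
    distinct : Unique edges

open Graph public

data Adj {n : ℕ} (G : Graph n) : Fin n → Fin n → Set where
  fwd : ∀ {u v} → (u , v) ∈ edges G → Adj G u v
  bwd : ∀ {u v} → (u , v) ∈ edges G → Adj G v u

data Reach {n : ℕ} (G : Graph n) : Fin n → Fin n → Set where
  here : ∀ {u} → Reach G u u
  step : ∀ {u v w} → Adj G u v → Reach G v w → Reach G u w

Connected : ∀ {n} → Graph n → Set
Connected {n} G = (u v : Fin n) → Reach G u v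

∣E∣ : ∀ {n} → Graph n → ℕ
∣E∣ G = length (edges G)

weight : ∀ {n} → (Fin n → ℕ) → Fin n × Fin n → ℕ
weight φ (u , v) = φ u + φ v

record IsESD {n : ℕ} (G : Graph n) (l : ℕ) (φ : Fin n → ℕ) : Set where
  field
    range     : (v : Fin n) → 1 ≤ φ v × φ v ≤ l
    injective : Injective _≡_ _≡_ φ
    weights   : Unique (map (weight φ) (edges G))

HasCanonicalESD : ∀ {n} → Graph n → Set
HasCanonicalESD {n} G = Σ (Fin n → ℕ) (IsESD G n)

module Submission where

-- The witness G_n is the square of the path on n vertices: vertices
-- 0, …, n-1, with i adjacent to i+1 and to i+2.  It has (n-1) + (n-2)
-- = 2n-3 edges, and under the labeling φ(i) = n - i the edge weights are
-- exactly 2n-1, 2n-2, …, 3, hence pairwise distinct.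
--
-- The graph is built recursively on n = 2 + m vertices: the square path
-- on 3 + m vertices is the one on 2 + m vertices shifted up by one, plus a
-- new vertex 0 joined to 1 and 2.  Shifting a vertex up by one does not
-- change its label n - i, so the edge weights of the shifted copy are the
-- old ones and the two new edges contribute the two new largest weights.

open import Defs
open import Data.Nat using (ℕ; zero; suc; _<_; _≤_; s≤s; z≤n; _+_; _∸_; _*_)
open import Data.Nat.Properties
  using (m<n⇒0<n∸m; m∸n≤m; ∸-cancelˡ-≡; <⇒≤; +-cancelˡ-≡)
open import Data.Nat.Tactic.RingSolver using (solve-∀)
open import Data.Fin as Fin using (Fin; toℕ)
open import Data.Fin.Properties using (toℕ<n; toℕ-injective)
open import Data.Product using (Σ; _×_; _,_; proj₁; proj₂)
open import Data.List using (List; []; _∷_; map; length; downFrom)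
open import Data.List.Properties using (map-∘; length-map; length-downFrom)
open import Data.List.Membership.Propositional using (_∈_)
open import Data.List.Membership.Propositional.Properties using (∈-map⁺)
open import Data.List.Relation.Unary.All using (All; _∷_; [])
open import Data.List.Relation.Unary.All.Properties using () renaming (map⁺ to All-map⁺)
open import Data.List.Relation.Unary.Any using (here; there)
open import Data.List.Relation.Unary.Unique.Propositional using (Unique)
open import Data.List.Relation.Unary.Unique.Propositional.Properties
  using (downFrom⁺) renaming (map⁺ to Unique-map⁺; map⁻ to Unique-map⁻)
open import Relation.Binary.PropositionalEquality using (_≡_; refl; sym; trans; cong; cong₂; subst; module ≡-Reasoning)

Adj-sym : ∀ {n} {G : Graph n} {u v} → Adj G u v → Adj G v u
Adj-sym (fwd e) = bwd e
Adj-sym (bwd e) = fwd e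

Reach-trans : ∀ {n} {G : Graph n} {u v w} → Reach G u v → Reach G v w → Reach G u w
Reach-trans here        q = q
Reach-trans (step a p) q = step a (Reach-trans p q)

Reach-sym : ∀ {n} {G : Graph n} {u v} → Reach G u v → Reach G v u
Reach-sym here       = here
Reach-sym (step a p) = Reach-trans (Reach-sym p) (step (Adj-sym a) here)

rooted⇒connected : ∀ {n} (G : Graph n) (r : Fin n) →
                   (∀ u → Reach G u r) → Connected G
rooted⇒connected G r toRoot u v = Reach-trans (toRoot u) (Reach-sym (toRoot v))

Reach-map : ∀ {n n′} {G : Graph n} {H : Graph n′} (f : Fin n → Fin n′) →
            (∀ {u v} → (u , v) ∈ edges G → (f u , f v) ∈ edges H) →
            ∀ {u v} → Reach G u v → Reach H (f u) (f v)
Reach-map f emb here             = here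
Reach-map f emb (step (fwd e) p) = step (fwd (emb e)) (Reach-map f emb p)
Reach-map f emb (step (bwd e) p) = step (bwd (emb e)) (Reach-map f emb p)

shift : ∀ {n} → Fin n × Fin n → Fin (suc n) × Fin (suc n)
shift (u , v) = Fin.suc u , Fin.suc v

sqEdges : (m : ℕ) → List (Fin (2 + m) × Fin (2 + m))
sqEdges zero    = (Fin.zero , Fin.suc Fin.zero) ∷ []
sqEdges (suc m) = (Fin.zero , Fin.suc Fin.zero)
                ∷ (Fin.zero , Fin.suc (Fin.suc Fin.zero))
                ∷ map shift (sqEdges m)

sqEdges-ordered : ∀ m → All (λ e → proj₁ e Fin.< proj₂ e) (sqEdges m)
sqEdges-ordered zero    = s≤s z≤n ∷ []
sqEdges-ordered (suc m) = s≤s z≤n ∷ s≤s z≤n ∷ All-map⁺ (shifted (sqEdges-ordered m))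
  where
  shifted : ∀ {xs : List (Fin (2 + m) × Fin (2 + m))} →
            All (λ e → proj₁ e Fin.< proj₂ e) xs →
            All (λ e → proj₁ (shift e) Fin.< proj₂ (shift e)) xs
  shifted []       = []
  shifted (p ∷ ps) = s≤s p ∷ shifted ps

label : (n : ℕ) → Fin n → ℕ
label n i = n ∸ toℕ i

label-range : ∀ n (v : Fin n) → 1 ≤ label n v × label n v ≤ n
label-range n v = m<n⇒0<n∸m (toℕ<n v) , m∸n≤m n (toℕ v)

label-injective : ∀ n {x y : Fin n} → label n x ≡ label n y → x ≡ y
label-injective n {x} {y} eq =
  toℕ-injective (∸-cancelˡ-≡ (<⇒≤ (toℕ<n x)) (<⇒≤ (toℕ<n y)) eq)

weights-shift : ∀ {n} (es : List (Fin n × Fin n)) →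
                map (weight (label (suc n))) (map shift es) ≡ map (weight (label n)) es
weights-shift es = sym (map-∘ es)

sqWeights : ∀ m → map (weight (label (2 + m))) (sqEdges m) ≡ map (3 +_) (downFrom (2 * m + 1))
sqWeights zero    = refl
sqWeights (suc m) = begin
  (3 + m) + (2 + m) ∷ (3 + m) + (1 + m) ∷ map (weight (label (3 + m))) (map shift (sqEdges m))
    ≡⟨ cong (λ ws → (3 + m) + (2 + m) ∷ (3 + m) + (1 + m) ∷ ws)
            (trans (weights-shift (sqEdges m)) (sqWeights m)) ⟩
  (3 + m) + (2 + m) ∷ (3 + m) + (1 + m) ∷ map (3 +_) (downFrom (2 * m + 1))
    ≡⟨ cong₂ (λ top next → top ∷ next ∷ map (3 +_) (downFrom (2 * m + 1)))
             (newTop m) (newNext m) ⟩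
  map (3 +_) (downFrom (suc (suc (2 * m + 1))))
    ≡⟨ cong (λ k → map (3 +_) (downFrom k)) (sym (count-step m)) ⟩
  map (3 +_) (downFrom (2 * suc m + 1)) ∎
  where
  open ≡-Reasoning
  newTop : ∀ m → (3 + m) + (2 + m) ≡ 3 + suc (2 * m + 1)
  newTop = solve-∀
  newNext : ∀ m → (3 + m) + (1 + m) ≡ 3 + (2 * m + 1)
  newNext = solve-∀
  count-step : ∀ m → 2 * suc m + 1 ≡ suc (suc (2 * m + 1))
  count-step = solve-∀

sqWeights-distinct : ∀ m → Unique (map (weight (label (2 + m))) (sqEdges m))
sqWeights-distinct m =
  subst Unique (sym (sqWeights m)) (Unique-map⁺ (+-cancelˡ-≡ 3 _ _) (downFrom⁺ (2 * m + 1)))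

sqEdges-length : ∀ m → length (sqEdges m) ≡ 2 * (2 + m) ∸ 3
sqEdges-length m = begin
  length (sqEdges m)                                     ≡⟨ sym (length-map (weight (label (2 + m))) (sqEdges m)) ⟩
  length (map (weight (label (2 + m))) (sqEdges m))      ≡⟨ cong length (sqWeights m) ⟩
  length (map (3 +_) (downFrom (2 * m + 1)))             ≡⟨ length-map (3 +_) (downFrom (2 * m + 1)) ⟩
  length (downFrom (2 * m + 1))                          ≡⟨ length-downFrom (2 * m + 1) ⟩
  2 * m + 1                                              ≡⟨ cong (_∸ 3) (sym (doubled m)) ⟩
  2 * (2 + m) ∸ 3                                        ∎
  where
  open ≡-Reasoning
  doubled : ∀ m → 2 * (2 + m) ≡ 3 + (2 * m + 1)
  doubled = solve-∀

-- Distinct weights force distinct edges, so the edge list is a simple graph.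
Sq : (m : ℕ) → Graph (2 + m)
Sq m = record
  { edges    = sqEdges m
  ; ordered  = sqEdges-ordered m
  ; distinct = Unique-map⁻ (sqWeights-distinct m)
  }

Sq-canonicalESD : ∀ m → IsESD (Sq m) (2 + m) (label (2 + m))
Sq-canonicalESD m = record
  { range     = label-range (2 + m)
  ; injective = label-injective (2 + m)
  ; weights   = sqWeights-distinct m
  }

shift-edge : ∀ m {u v} → (u , v) ∈ sqEdges m →
             (Fin.suc u , Fin.suc v) ∈ sqEdges (suc m)
shift-edge m e = there (there (∈-map⁺ shift e))

-- Every vertex reaches vertex 0: vertex i + 1 reaches 1 inside the shifted
-- copy, and 1 is adjacent to 0.
Sq-reachesZero : ∀ m (u : Fin (2 + m)) → Reach (Sq m) u Fin.zero
Sq-reachesZero zero    Fin.zero            = here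
Sq-reachesZero zero    (Fin.suc Fin.zero)  = step (bwd (here refl)) here
Sq-reachesZero (suc m) Fin.zero            = here
Sq-reachesZero (suc m) (Fin.suc u)         =
  Reach-trans (Reach-map Fin.suc (shift-edge m) (Sq-reachesZero m u))
              (step (bwd (here refl)) here)

theorem2 : (n : ℕ) → 1 < n →
    Σ (Graph n) (λ G → Connected G × (∣E∣ G ≡ 2 * n ∸ 3) × HasCanonicalESD G)
theorem2 (suc (suc m)) _ =
  Sq m
  , rooted⇒connected (Sq m) Fin.zero (Sq-reachesZero m)
  , sqEdges-length m
  , (label (2 + m) , Sq-canonicalESD m)
theorem2 (suc zero) (s≤s ())
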